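{- Let $\ell$-free notation be as follows: for integers $m\ge0$ and $N\ge1$, let $L(m,N)$ be the number of partitions of $N$ into $m$ parts whose largest part, say $n$, appears at least $n$ times, and let $R(k,N)$ be the number of Rogers--Ramanujan partitions of $N$ with rank $k$. Then $L(m,N)=R(m-1,N)$.
   Context: A Rogers--Ramanujan partition is a partition in which any two parts differ by at least $2$. The rank of a partition is its largest part minus its number of parts. -}

module Defs where

open import Data.Nat using (ℕ; zero; suc; _+_; _≤_; _<_; _⊔_; _≟_; _≤?_; _<?_)
open import Data.Integer using (ℤ; +_; _-_) renaming (_≟_ to _≟ℤ_)
open import Data.List using (List; []; _∷_; length; filter; map; foldr; concatMap; upTo; _++_)
open import Data.Nat.ListAction using (sum)
open import Data.List.Relation.Unary.All using (All; all?)
open import Data.List.Relation.Unary.Linked using (Linked; linked?)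
open import Data.Product using (_×_)
open import Relation.Binary.PropositionalEquality using (_≡_)
open import Relation.Nullary using (Dec; _×-dec_)

IsPartition : ℕ → List ℕ → Set
IsPartition N xs = All (λ x → 1 ≤ x) xs × Linked (λ a b → b ≤ a) xs × sum xs ≡ N

IsRRPartition : ℕ → List ℕ → Set
IsRRPartition N xs = All (λ x → 1 ≤ x) xs × Linked (λ a b → b + 2 ≤ a) xs × sum xs ≡ N

largest : List ℕ → ℕ
largest = foldr _⊔_ 0

mult : ℕ → List ℕ → ℕ
mult n xs = length (filter (λ x → x ≟ n) xs)

rank : List ℕ → ℤ
rank xs = + largest xs - + length xs

listsOf : ℕ → ℕ → List (List ℕ)
listsOf b zero = [] ∷ []
listsOf b (suc ℓ) = concatMap (λ x → map (x ∷_) (listsOf b ℓ)) (upTo (suc b))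

-- all lists of length ≤ N with entries ≤ N (contains every partition of N exactly once)
candidates : ℕ → List (List ℕ)
candidates N = concatMap (listsOf N) (upTo (suc N))

isPartition? : ∀ N xs → Dec (IsPartition N xs)
isPartition? N xs = all? (λ x → 1 ≤? x) xs ×-dec (linked? (λ a b → b ≤? a) xs ×-dec (sum xs ≟ N))

isRRPartition? : ∀ N xs → Dec (IsRRPartition N xs)
isRRPartition? N xs = all? (λ x → 1 ≤? x) xs ×-dec (linked? (λ a b → b + 2 ≤? a) xs ×-dec (sum xs ≟ N))

LCond : ℕ → ℕ → List ℕ → Set
LCond m N xs = IsPartition N xs × length xs ≡ m × largest xs ≤ mult (largest xs) xs

LCond? : ∀ m N xs → Dec (LCond m N xs)
LCond? m N xs = isPartition? N xs ×-dec ((length xs ≟ m) ×-dec (largest xs ≤? mult (largest xs) xs))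

RCond : ℤ → ℕ → List ℕ → Set
RCond k N xs = IsRRPartition N xs × rank xs ≡ k

RCond? : ∀ k N xs → Dec (RCond k N xs)
RCond? k N xs = isRRPartition? N xs ×-dec (rank xs ≟ℤ k)

L : ℕ → ℕ → ℕ
L m N = length (filter (LCond? m N) (candidates N))

R : ℤ → ℕ → ℕ
R k N = length (filter (RCond? k N) (candidates N))

module Submission where

-- An L-partition with largest part n is an n × n square of parts n followed by an arbitrary
-- partition into parts ≤ n, which is recorded by the multiplicities a₁, …, aₙ of 1, …, n.
-- A Rogers–Ramanujan partition y₁ > ⋯ > yₙ is recorded by its excess gaps bⱼ = yⱼ − yⱼ₊₁ − 2
-- (with yₙ₊₁ = −1). Both codes range over all of ℕⁿ, and identifying aⱼ with bⱼ preserves the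
-- size n² + Σ j·aⱼ, while the L-partition has n + Σ aⱼ parts and the Rogers–Ramanujan partition
-- has rank n − 1 + Σ bⱼ. Both codes are stored from the largest part down, so they are listed
-- in opposite orders and the bijection reverses them.

open import Defs
open import Data.Nat using (ℕ; zero; suc; _+_; _*_; _∸_; _≤_; _<_; _⊔_; _≟_; z≤n; s≤s; s≤s⁻¹)
open import Data.Nat.Properties
open import Data.Nat.ListAction using (sum)
open import Data.Nat.ListAction.Properties using (sum-↭)
open import Data.Nat.Tactic.RingSolver using (solve-∀)
open import Data.Integer using (+_; _-_; _⊖_)
open import Data.Integer.Properties using ([+m]-[+n]≡m⊖n; +-cancelˡ-⊖; +-injective)
open import Data.List
  using (List; []; _∷_; [_]; _∷ʳ_; _++_; length; filter; map; concatMap; replicate; drop; reverse; upTo)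
open import Data.List.Properties
  using ( length-++; length-++-sucʳ; length-replicate; length-reverse; reverse-involutive; unfold-reverse
        ; filter-accept; filter-reject; filter-none; ∷-injectiveʳ)
open import Data.List.Relation.Binary.Permutation.Propositional.Properties using (↭-reverse)
open import Data.List.Relation.Unary.All as All using (All; []; _∷_)
open import Data.List.Relation.Unary.All.Properties using (++⁺; ++⁻ʳ; drop⁺; replicate⁺)
open import Data.List.Relation.Unary.Any using (here; there)
open import Data.List.Relation.Unary.AllPairs using ([]; _∷_)
open import Data.List.Relation.Unary.Linked as Linked using (Linked; []; [-]; _∷_)
open import Data.List.Relation.Unary.Linked.Properties using (Linked⇒All)
open import Data.List.Relation.Unary.Unique.Propositional using (Unique)
open import Data.List.Relation.Unary.Unique.Propositional.Properties as Unique using (upTo⁺)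
open import Data.List.Membership.Propositional using (_∈_; find; lose)
open import Data.List.Membership.Propositional.Properties
  using ( ∈-∃++; ∈-++⁻; ∈-++⁺ˡ; ∈-++⁺ʳ; ∈-filter⁻; ∈-filter⁺
        ; ∈-concatMap⁻; ∈-concatMap⁺; ∈-map⁻; ∈-map⁺; ∈-upTo⁺)
open import Data.Product using (Σ-syntax; _×_; _,_; proj₁; proj₂)
open import Data.Sum using (inj₁; inj₂)
open import Data.Empty using (⊥-elim)
open import Function using (_∘_)
open import Relation.Binary.PropositionalEquality
  using (_≡_; _≢_; refl; sym; trans; cong; cong₂; subst; module ≡-Reasoning)
open import Relation.Nullary using (¬_; yes; no)
open import Relation.Unary using (Decidable)

private variable
  A B : Set

length-≤-of-left-inverse : (f : A → B) (g : B → A) {xs : List A} {ys : List B} → Unique xs →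
                            (∀ {x} → x ∈ xs → f x ∈ ys) → (∀ {x} → x ∈ xs → g (f x) ≡ x) →
                            length xs ≤ length ys
length-≤-of-left-inverse f g {[]}     _             _  _  = z≤n
length-≤-of-left-inverse f g {x ∷ xs} (x∉xs ∷ xs!) f∈ gf with ∈-∃++ (f∈ (here refl))
... | ys₁ , ys₂ , refl = begin
  suc (length xs)           ≤⟨ s≤s (length-≤-of-left-inverse f g xs! f∈′ (gf ∘ there)) ⟩
  suc (length (ys₁ ++ ys₂)) ≡⟨ length-++-sucʳ ys₁ (f x) ys₂ ⟨
  length (ys₁ ++ f x ∷ ys₂) ∎
  where
  open ≤-Reasoning
  f∈′ : ∀ {x′} → x′ ∈ xs → f x′ ∈ ys₁ ++ ys₂
  f∈′ {x′} x′∈xs with ∈-++⁻ ys₁ (f∈ (there x′∈xs))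
  ... | inj₁ p             = ∈-++⁺ˡ p
  ... | inj₂ (there p)     = ∈-++⁺ʳ ys₁ p
  ... | inj₂ (here fx′≡fx) =
    ⊥-elim (All.lookup x∉xs x′∈xs
      (trans (sym (gf (here refl))) (trans (cong g (sym fx′≡fx)) (gf (there x′∈xs)))))

length-filter-≤ : {P : A → Set} {Q : B → Set} (P? : Decidable P) (Q? : Decidable Q) {C : List A} {D : List B} →
                  Unique C → (∀ {y} → Q y → y ∈ D) → (f : A → B) (g : B → A) →
                  (∀ {x} → P x → Q (f x)) → (∀ {x} → P x → g (f x) ≡ x) →
                  length (filter P? C) ≤ length (filter Q? D)
length-filter-≤ {P = P} P? Q? {C} {D} C! Q⊆D f g PQ gf =
  length-≤-of-left-inverse f g (Unique.filter⁺ P? C!)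
    (f∈ ∘ proj₂ ∘ ∈-filter⁻ P? {xs = C}) (gf ∘ proj₂ ∘ ∈-filter⁻ P? {xs = C})
  where
  f∈ : ∀ {x} → P x → f x ∈ filter Q? D
  f∈ Px = ∈-filter⁺ Q? (Q⊆D (PQ Px)) (PQ Px)

length-filter-≡ : {P : A → Set} {Q : B → Set} (P? : Decidable P) (Q? : Decidable Q) {C : List A} {D : List B} →
                  Unique C → Unique D → (∀ {x} → P x → x ∈ C) → (∀ {y} → Q y → y ∈ D) →
                  (f : A → B) (g : B → A) →
                  (∀ {x} → P x → Q (f x)) → (∀ {y} → Q y → P (g y)) →
                  (∀ {x} → P x → g (f x) ≡ x) → (∀ {y} → Q y → f (g y) ≡ y) →
                  length (filter P? C) ≡ length (filter Q? D)
length-filter-≡ P? Q? C! D! P⊆C Q⊆D f g PQ QP gf fg =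
  ≤-antisym (length-filter-≤ P? Q? C! Q⊆D f g PQ gf) (length-filter-≤ Q? P? D! P⊆C g f QP fg)

concatMap-unique : (key : B → A) (f : A → List B) {xs : List A} → Unique xs →
                   (∀ x → Unique (f x)) → (∀ x {y} → y ∈ f x → key y ≡ x) →
                   Unique (concatMap f xs)
concatMap-unique key f {[]} _ _ _ = []
concatMap-unique key f {x ∷ xs} (x∉xs ∷ xs!) f! key∘f =
  Unique.++⁺ (f! x) (concatMap-unique key f xs! f! key∘f) disjoint
  where
  disjoint : ∀ {y} → ¬ (y ∈ f x × y ∈ concatMap f xs)
  disjoint (y∈fx , y∈rest) with find (∈-concatMap⁻ f y∈rest)
  ... | x′ , x′∈xs , y∈fx′ = All.lookup x∉xs x′∈xs (trans (sym (key∘f x y∈fx)) (key∘f x′ y∈fx′))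

head₀ : List ℕ → ℕ
head₀ []      = 0
head₀ (x ∷ _) = x

listsOf-unique : ∀ b ℓ → Unique (listsOf b ℓ)
listsOf-unique b zero    = [] ∷ []
listsOf-unique b (suc ℓ) = concatMap-unique head₀ _ (upTo⁺ (suc b))
  (λ x → Unique.map⁺ ∷-injectiveʳ (listsOf-unique b ℓ))
  (λ x y∈ → cong head₀ (proj₂ (proj₂ (∈-map⁻ (x ∷_) y∈))))

length-∈-listsOf : ∀ b ℓ {xs} → xs ∈ listsOf b ℓ → length xs ≡ ℓ
length-∈-listsOf b zero    (here refl) = refl
length-∈-listsOf b (suc ℓ) xs∈
  with find (∈-concatMap⁻ (λ x → map (x ∷_) (listsOf b ℓ)) {xs = upTo (suc b)} xs∈)
... | x , _ , xs∈x∷ with ∈-map⁻ (x ∷_) xs∈x∷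
...   | ys , ys∈ , refl = cong suc (length-∈-listsOf b ℓ ys∈)

candidates-unique : ∀ N → Unique (candidates N)
candidates-unique N = concatMap-unique length (listsOf N) (upTo⁺ (suc N)) (listsOf-unique N) (length-∈-listsOf N)

∈-listsOf : ∀ b {xs} → All (_≤ b) xs → xs ∈ listsOf b (length xs)
∈-listsOf b {[]}     []           = here refl
∈-listsOf b {x ∷ xs} (x≤b ∷ xs≤b) =
  ∈-concatMap⁺ (λ x → map (x ∷_) (listsOf b (length xs)))
    (lose (∈-upTo⁺ (s≤s x≤b)) (∈-map⁺ (x ∷_) (∈-listsOf b xs≤b)))

∈-candidates : ∀ N {xs} → All (_≤ N) xs → length xs ≤ N → xs ∈ candidates N
∈-candidates N xs≤N |xs|≤N = ∈-concatMap⁺ (listsOf N) (lose (∈-upTo⁺ (s≤s |xs|≤N)) (∈-listsOf N xs≤N))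

Positive : List ℕ → Set
Positive = All (λ x → 1 ≤ x)

length≤sum : ∀ {xs} → Positive xs → length xs ≤ sum xs
length≤sum []         = z≤n
length≤sum (1≤x ∷ ps) = +-mono-≤ 1≤x (length≤sum ps)

all≤sum : ∀ xs → All (_≤ sum xs) xs
all≤sum []       = []
all≤sum (x ∷ xs) = m≤m+n x (sum xs) ∷ All.map (λ y≤ → ≤-trans y≤ (m≤n+m (sum xs) x)) (all≤sum xs)

positive∈candidates : ∀ {xs N} → Positive xs → sum xs ≡ N → xs ∈ candidates N
positive∈candidates {xs} ps refl = ∈-candidates (sum xs) (all≤sum xs) (length≤sum ps)

NonIncreasing : List ℕ → Set
NonIncreasing = Linked (λ a b → b ≤ a)

raise-head : ∀ {x y ys} → y ≤ x → NonIncreasing (y ∷ ys) → NonIncreasing (x ∷ ys)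
raise-head {ys = []}     _   _           = [-]
raise-head {ys = z ∷ zs} y≤x (z≤y ∷ ni) = ≤-trans z≤y y≤x ∷ ni

drop-nonIncreasing : ∀ k {x ys} → NonIncreasing (x ∷ ys) → NonIncreasing (x ∷ drop k ys)
drop-nonIncreasing zero    ni = ni
drop-nonIncreasing (suc k) {ys = []}    ni           = ni
drop-nonIncreasing (suc k) {ys = _ ∷ _} (y≤x ∷ ni) = drop-nonIncreasing k (raise-head y≤x ni)

replicate-nonIncreasing : ∀ k {x ys} → NonIncreasing (x ∷ ys) → NonIncreasing (x ∷ replicate k x ++ ys)
replicate-nonIncreasing zero    ni = ni
replicate-nonIncreasing (suc k) ni = ≤-refl ∷ replicate-nonIncreasing k ni

all≤head : ∀ {x ys} → NonIncreasing (x ∷ ys) → All (_≤ x) ys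
all≤head {ys = []}    _          = []
all≤head {ys = _ ∷ _} (y≤x ∷ ni) = Linked⇒All (λ j≤i k≤j → ≤-trans k≤j j≤i) y≤x ni

largest-nonIncreasing : ∀ {x xs} → NonIncreasing (x ∷ xs) → largest (x ∷ xs) ≡ x
largest-nonIncreasing {x} {[]}    _          = ⊔-identityʳ x
largest-nonIncreasing {x} {_ ∷ _} (y≤x ∷ ni) =
  trans (cong (x ⊔_) (largest-nonIncreasing ni)) (m≥n⇒m⊔n≡m y≤x)

largest-∷-nonIncreasing : ∀ {xs} → NonIncreasing xs → NonIncreasing (largest xs ∷ xs)
largest-∷-nonIncreasing {[]}         _  = [-]
largest-∷-nonIncreasing {xs@(_ ∷ _)} ni =
  subst (λ y → NonIncreasing (y ∷ xs)) (sym (largest-nonIncreasing ni)) (≤-refl ∷ ni)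

mult-here : ∀ k xs → mult k (k ∷ xs) ≡ suc (mult k xs)
mult-here k xs = cong length (filter-accept (_≟ k) refl)

mult-there : ∀ {k x} xs → x ≢ k → mult k (x ∷ xs) ≡ mult k xs
mult-there {k} xs x≢k = cong length (filter-reject (_≟ k) x≢k)

mult-replicate-++ : ∀ a k xs → mult k (replicate a k ++ xs) ≡ a + mult k xs
mult-replicate-++ zero    k xs = refl
mult-replicate-++ (suc a) k xs = trans (mult-here k _) (cong suc (mult-replicate-++ a k xs))

mult-replicate-≢-++ : ∀ a {j k} xs → j ≢ k → mult j (replicate a k ++ xs) ≡ mult j xs
mult-replicate-≢-++ zero    xs j≢k = refl
mult-replicate-≢-++ (suc a) xs j≢k = trans (mult-there _ (j≢k ∘ sym)) (mult-replicate-≢-++ a xs j≢k)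

mult-all< : ∀ {k xs} → All (_< k) xs → mult k xs ≡ 0
mult-all< {k} xs<k = cong length (filter-none (_≟ k) (All.map <⇒≢ xs<k))

all<head : ∀ {k x xs} → NonIncreasing (k ∷ x ∷ xs) → x ≢ k → All (_< k) (x ∷ xs)
all<head (x≤k ∷ ni) x≢k = x<k ∷ All.map (λ y≤x → ≤-<-trans y≤x x<k) (all≤head ni)
  where x<k = ≤∧≢⇒< x≤k x≢k

run-decomposition : ∀ k {xs} → NonIncreasing (suc k ∷ xs) →
                    Σ[ ys ∈ List ℕ ] xs ≡ replicate (mult (suc k) xs) (suc k) ++ ys × NonIncreasing (k ∷ ys)
run-decomposition k {[]}     _ = [] , refl , [-]
run-decomposition k {x ∷ xs} ni@(x≤k+1 ∷ ni′) with x ≟ suc k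
... | yes refl rewrite mult-here x xs =
  let ys , xs≡ , ni-ys = run-decomposition k ni′ in ys , cong (x ∷_) xs≡ , ni-ys
... | no x≢k+1 rewrite mult-all< (all<head ni x≢k+1) =
  x ∷ xs , refl , s≤s⁻¹ (≤∧≢⇒< x≤k+1 x≢k+1) ∷ ni′

multiplicities : ℕ → List ℕ → List ℕ
multiplicities zero    xs = []
multiplicities (suc k) xs = mult (suc k) xs ∷ multiplicities k xs

fromMultiplicities : List ℕ → List ℕ
fromMultiplicities []       = []
fromMultiplicities (a ∷ as) = replicate a (suc (length as)) ++ fromMultiplicities as

length-multiplicities : ∀ k xs → length (multiplicities k xs) ≡ k
length-multiplicities zero    xs = refl
length-multiplicities (suc k) xs = cong suc (length-multiplicities k xs)

multiplicities-replicate-++ : ∀ {k x} a xs → k < x → multiplicities k (replicate a x ++ xs) ≡ multiplicities k xs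
multiplicities-replicate-++ {zero}  a xs k<x = refl
multiplicities-replicate-++ {suc k} a xs k<x = cong₂ _∷_
  (mult-replicate-≢-++ a xs (<⇒≢ k<x))
  (multiplicities-replicate-++ a xs (<⇒≤ k<x))

fromMultiplicities-nonIncreasing : ∀ as → NonIncreasing (length as ∷ fromMultiplicities as)
fromMultiplicities-nonIncreasing []       = [-]
fromMultiplicities-nonIncreasing (a ∷ as) =
  replicate-nonIncreasing a (raise-head (n≤1+n _) (fromMultiplicities-nonIncreasing as))

multiplicities-fromMultiplicities : ∀ as → multiplicities (length as) (fromMultiplicities as) ≡ as
multiplicities-fromMultiplicities []       = refl
multiplicities-fromMultiplicities (a ∷ as) = cong₂ _∷_
  (begin
    mult (suc n) (replicate a (suc n) ++ fromMultiplicities as) ≡⟨ mult-replicate-++ a (suc n) _ ⟩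
    a + mult (suc n) (fromMultiplicities as)                    ≡⟨ cong (_+_ a) (mult-all< below) ⟩
    a + 0                                                      ≡⟨ +-identityʳ a ⟩
    a                                                          ∎)
  (begin
    multiplicities n (replicate a (suc n) ++ fromMultiplicities as) ≡⟨ multiplicities-replicate-++ a _ ≤-refl ⟩
    multiplicities n (fromMultiplicities as)                       ≡⟨ multiplicities-fromMultiplicities as ⟩
    as                                                             ∎)
  where
  open ≡-Reasoning
  n = length as
  below : All (_< suc n) (fromMultiplicities as)
  below = All.map s≤s (all≤head (fromMultiplicities-nonIncreasing as))

fromMultiplicities-multiplicities : ∀ k {xs} → NonIncreasing (k ∷ xs) → Positive xs →
                                    fromMultiplicities (multiplicities k xs) ≡ xs
fromMultiplicities-multiplicities zero    {[]}    _           _         = refl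
fromMultiplicities-multiplicities zero    {_ ∷ _} (x≤0 ∷ _)   (1≤x ∷ _) = ⊥-elim (1+n≰n (≤-trans 1≤x x≤0))
fromMultiplicities-multiplicities (suc k) {xs}    ni          ps        with run-decomposition k ni
... | ys , xs≡ , ni-ys = begin
  replicate c (suc (length (multiplicities k xs))) ++ fromMultiplicities (multiplicities k xs)
    ≡⟨ cong (λ n → replicate c (suc n) ++ fromMultiplicities (multiplicities k xs)) (length-multiplicities k xs) ⟩
  replicate c (suc k) ++ fromMultiplicities (multiplicities k xs)
    ≡⟨ cong (λ zs → replicate c (suc k) ++ fromMultiplicities (multiplicities k zs)) xs≡ ⟩
  replicate c (suc k) ++ fromMultiplicities (multiplicities k (replicate c (suc k) ++ ys))
    ≡⟨ cong (λ zs → replicate c (suc k) ++ fromMultiplicities zs) (multiplicities-replicate-++ {k} c ys ≤-refl) ⟩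
  replicate c (suc k) ++ fromMultiplicities (multiplicities k ys)
    ≡⟨ cong (replicate c (suc k) ++_) (fromMultiplicities-multiplicities k ni-ys ps-ys) ⟩
  replicate c (suc k) ++ ys
    ≡⟨ xs≡ ⟨
  xs ∎
  where
  open ≡-Reasoning
  c = mult (suc k) xs
  ps-ys : Positive ys
  ps-ys = ++⁻ʳ (replicate c (suc k)) (subst Positive xs≡ ps)

replicate-++-drop : ∀ k {x xs} → NonIncreasing (x ∷ xs) → k ≤ mult x xs → replicate k x ++ drop k xs ≡ xs
replicate-++-drop zero    _ _ = refl
replicate-++-drop (suc k) {x} {y ∷ xs} ni@(_ ∷ ni′) k+1≤mult with y ≟ x
... | yes refl = cong (y ∷_) (replicate-++-drop k ni′ (s≤s⁻¹ (subst (suc k ≤_) (mult-here y xs) k+1≤mult)))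
... | no y≢x   = ⊥-elim (n≮0 (subst (suc k ≤_) (mult-all< (all<head ni y≢x)) k+1≤mult))

weight : List ℕ → ℕ
weight []       = 0
weight (a ∷ as) = a * suc (length as) + weight as

lPartition : List ℕ → List ℕ
lPartition as = replicate (length as) (length as) ++ fromMultiplicities as

lCode : List ℕ → List ℕ
lCode xs = multiplicities (largest xs) (drop (largest xs) xs)

lPartition-nonIncreasing : ∀ as → NonIncreasing (lPartition as)
lPartition-nonIncreasing as =
  Linked.tail (replicate-nonIncreasing (length as) (fromMultiplicities-nonIncreasing as))

lPartition-positive : ∀ as → Positive (lPartition as)
lPartition-positive as = ++⁺ (square-positive (length as)) (fromMultiplicities-positive as)
  where
  square-positive : ∀ n → Positive (replicate n n)
  square-positive zero    = []
  square-positive (suc n) = replicate⁺ (suc n) (s≤s z≤n)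
  fromMultiplicities-positive : ∀ as → Positive (fromMultiplicities as)
  fromMultiplicities-positive []       = []
  fromMultiplicities-positive (a ∷ as) = ++⁺ (replicate⁺ a (s≤s z≤n)) (fromMultiplicities-positive as)

largest-lPartition : ∀ as → largest (lPartition as) ≡ length as
largest-lPartition []          = refl
largest-lPartition as@(_ ∷ _) = largest-nonIncreasing (lPartition-nonIncreasing as)

lPartition-square : ∀ as → largest (lPartition as) ≤ mult (largest (lPartition as)) (lPartition as)
lPartition-square as rewrite largest-lPartition as | mult-replicate-++ (length as) (length as) (fromMultiplicities as) =
  m≤m+n (length as) _

length-lPartition : ∀ as → length (lPartition as) ≡ length as + sum as
length-lPartition as = trans (length-++ (replicate n n)) (cong₂ _+_ (length-replicate n) (length-fromMultiplicities as))
  where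
  n = length as
  length-fromMultiplicities : ∀ as → length (fromMultiplicities as) ≡ sum as
  length-fromMultiplicities []       = refl
  length-fromMultiplicities (a ∷ as) =
    trans (length-++ (replicate a _)) (cong₂ _+_ (length-replicate a) (length-fromMultiplicities as))

sum-replicate-++ : ∀ k x ys → sum (replicate k x ++ ys) ≡ k * x + sum ys
sum-replicate-++ zero    x ys = refl
sum-replicate-++ (suc k) x ys = trans (cong (_+_ x) (sum-replicate-++ k x ys)) (sym (+-assoc x (k * x) (sum ys)))

sum-lPartition : ∀ as → sum (lPartition as) ≡ length as * length as + weight as
sum-lPartition as = trans (sum-replicate-++ n n _) (cong (_+_ (n * n)) (sum-fromMultiplicities as))
  where
  n = length as
  sum-fromMultiplicities : ∀ as → sum (fromMultiplicities as) ≡ weight as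
  sum-fromMultiplicities []       = refl
  sum-fromMultiplicities (a ∷ as) =
    trans (sum-replicate-++ a _ _) (cong (_+_ (a * suc (length as))) (sum-fromMultiplicities as))

lCode-lPartition : ∀ as → lCode (lPartition as) ≡ as
lCode-lPartition as rewrite largest-lPartition as = begin
  multiplicities n (drop n (replicate n n ++ fromMultiplicities as)) ≡⟨ cong (multiplicities n) (drop-replicate-++ n) ⟩
  multiplicities n (fromMultiplicities as)                           ≡⟨ multiplicities-fromMultiplicities as ⟩
  as                                                                 ∎
  where
  open ≡-Reasoning
  n = length as
  drop-replicate-++ : ∀ k {x : ℕ} {ys} → drop k (replicate k x ++ ys) ≡ ys
  drop-replicate-++ zero    = refl
  drop-replicate-++ (suc k) = drop-replicate-++ k

lPartition-lCode : ∀ {xs} → Positive xs → NonIncreasing xs → largest xs ≤ mult (largest xs) xs →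
                   lPartition (lCode xs) ≡ xs
lPartition-lCode {xs} ps ni square = begin
  replicate (length code) (length code) ++ fromMultiplicities code
    ≡⟨ cong (λ k → replicate k k ++ fromMultiplicities code) (length-multiplicities n (drop n xs)) ⟩
  replicate n n ++ fromMultiplicities code
    ≡⟨ cong (replicate n n ++_) (fromMultiplicities-multiplicities n (drop-nonIncreasing n n∷xs) (drop⁺ n ps)) ⟩
  replicate n n ++ drop n xs
    ≡⟨ replicate-++-drop n n∷xs square ⟩
  xs ∎
  where
  open ≡-Reasoning
  n = largest xs
  code = lCode xs
  n∷xs = largest-∷-nonIncreasing ni

RRLinked : List ℕ → Set
RRLinked = Linked (λ a b → b + 2 ≤ a)

minAbove : List ℕ → ℕ
minAbove []      = 1
minAbove (y ∷ _) = y + 2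

rrPartition : List ℕ → List ℕ
rrPartition []       = []
rrPartition (b ∷ bs) = b + minAbove (rrPartition bs) ∷ rrPartition bs

rrCode : List ℕ → List ℕ
rrCode []       = []
rrCode (y ∷ ys) = y ∸ minAbove ys ∷ rrCode ys

rrPartition-rrLinked : ∀ bs → RRLinked (rrPartition bs)
rrPartition-rrLinked []           = []
rrPartition-rrLinked (b ∷ [])     = [-]
rrPartition-rrLinked (b ∷ c ∷ cs) = m≤n+m _ b ∷ rrPartition-rrLinked (c ∷ cs)

rrPartition-positive : ∀ bs → Positive (rrPartition bs)
rrPartition-positive []       = []
rrPartition-positive (b ∷ bs) = ≤-trans (1≤minAbove (rrPartition bs)) (m≤n+m _ b) ∷ rrPartition-positive bs
  where
  1≤minAbove : ∀ ys → 1 ≤ minAbove ys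
  1≤minAbove []      = ≤-refl
  1≤minAbove (y ∷ _) = ≤-trans (s≤s z≤n) (m≤n+m 2 y)

length-rrPartition : ∀ bs → length (rrPartition bs) ≡ length bs
length-rrPartition []       = refl
length-rrPartition (b ∷ bs) = cong suc (length-rrPartition bs)

rrLinked⇒nonIncreasing : ∀ {ys} → RRLinked ys → NonIncreasing ys
rrLinked⇒nonIncreasing = Linked.map (λ {a} {b} b+2≤a → ≤-trans (m≤m+n b 2) b+2≤a)

rrCode-rrPartition : ∀ bs → rrCode (rrPartition bs) ≡ bs
rrCode-rrPartition []       = refl
rrCode-rrPartition (b ∷ bs) = cong₂ _∷_ (m+n∸n≡m b (minAbove (rrPartition bs))) (rrCode-rrPartition bs)

rrPartition-rrCode : ∀ {ys} → RRLinked ys → Positive ys → rrPartition (rrCode ys) ≡ ys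
rrPartition-rrCode {[]}     _  _ = refl
rrPartition-rrCode {y ∷ ys} rr (1≤y ∷ ps) rewrite rrPartition-rrCode (Linked.tail rr) ps =
  cong (_∷ ys) (m∸n+n≡m (minAbove≤ rr 1≤y))
  where
  minAbove≤ : ∀ {y ys} → RRLinked (y ∷ ys) → 1 ≤ y → minAbove ys ≤ y
  minAbove≤ {ys = []}    _          1≤y = 1≤y
  minAbove≤ {ys = _ ∷ _} (z+2≤y ∷ _) _  = z+2≤y

minAbove-rrPartition : ∀ bs → minAbove (rrPartition bs) ≡ suc (length bs + length bs + sum bs)
minAbove-rrPartition []       = refl
minAbove-rrPartition (b ∷ bs) rewrite minAbove-rrPartition bs = rearrange b (length bs) (sum bs)
  where
  rearrange : ∀ b k s → b + suc (k + k + s) + 2 ≡ suc (suc k + suc k + (b + s))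
  rearrange = solve-∀

weight-∷ʳ : ∀ xs x → weight (xs ∷ʳ x) ≡ weight xs + sum xs + x
weight-∷ʳ []       x = trans (+-identityʳ (x * 1)) (*-identityʳ x)
weight-∷ʳ (y ∷ ys) x rewrite length-++ ys {[ x ]} | weight-∷ʳ ys x = rearrange y (length ys) (weight ys) (sum ys) x
  where
  rearrange : ∀ y k w s x → y * suc (k + 1) + (w + s + x) ≡ y * suc k + w + (y + s) + x
  rearrange = solve-∀

sum-reverse : ∀ xs → sum (reverse xs) ≡ sum xs
sum-reverse xs = sum-↭ (↭-reverse xs)

sum-rrPartition : ∀ bs → sum (rrPartition bs) ≡ length bs * length bs + weight (reverse bs)
sum-rrPartition []       = refl
sum-rrPartition (b ∷ bs)
  rewrite minAbove-rrPartition bs | sum-rrPartition bs | unfold-reverse b bs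
        | weight-∷ʳ (reverse bs) b | sum-reverse bs
  = rearrange b (length bs) (sum bs) (weight (reverse bs))
  where
  rearrange : ∀ b k s w → b + suc (k + k + s) + (k * k + w) ≡ suc k * suc k + (w + s + b)
  rearrange = solve-∀

+[m]-1-injective : ∀ {m n} → + m - + 1 ≡ + n - + 1 → m ≡ n
+[m]-1-injective {zero}  {zero}  _  = refl
+[m]-1-injective {suc m} {suc n} eq = cong suc (+-injective eq)

-- The empty partition has rank 0, not −1.
rank-rrPartition : ∀ bs → 1 ≤ sum (rrPartition bs) → rank (rrPartition bs) ≡ + (length bs + sum bs) - + 1
rank-rrPartition []       ()
rank-rrPartition (b ∷ bs) _  = begin
  + largest (rrPartition (b ∷ bs)) - + length (rrPartition (b ∷ bs))
    ≡⟨ cong₂ (λ y n → + y - + n) largest≡ (length-rrPartition (b ∷ bs)) ⟩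
  + (k + M) - + suc k ≡⟨ [+m]-[+n]≡m⊖n (k + M) (suc k) ⟩
  (k + M) ⊖ suc k     ≡⟨ cong ((k + M) ⊖_) (+-comm 1 k) ⟩
  (k + M) ⊖ (k + 1)   ≡⟨ +-cancelˡ-⊖ k M 1 ⟩
  M ⊖ 1               ≡⟨ [+m]-[+n]≡m⊖n M 1 ⟨
  + M - + 1           ∎
  where
  open ≡-Reasoning
  k = length bs
  M = suc k + (b + sum bs)
  rearrange : ∀ b k s → b + suc (k + k + s) ≡ k + (suc k + (b + s))
  rearrange = solve-∀
  largest≡ : largest (rrPartition (b ∷ bs)) ≡ k + M
  largest≡ = begin
    largest (rrPartition (b ∷ bs))
      ≡⟨ largest-nonIncreasing (rrLinked⇒nonIncreasing (rrPartition-rrLinked (b ∷ bs))) ⟩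
    b + minAbove (rrPartition bs)
      ≡⟨ cong (_+_ b) (minAbove-rrPartition bs) ⟩
    b + suc (k + k + sum bs)
      ≡⟨ rearrange b k (sum bs) ⟩
    k + M
      ∎

sum-rrPartition-reverse : ∀ as → sum (rrPartition (reverse as)) ≡ sum (lPartition as)
sum-rrPartition-reverse as rewrite sum-rrPartition (reverse as) | length-reverse as | reverse-involutive as =
  sym (sum-lPartition as)

rank-rrPartition-reverse : ∀ as → 1 ≤ sum (lPartition as) →
                           rank (rrPartition (reverse as)) ≡ + length (lPartition as) - + 1
rank-rrPartition-reverse as 1≤sum = begin
  rank (rrPartition (reverse as))
    ≡⟨ rank-rrPartition (reverse as) (subst (1 ≤_) (sym (sum-rrPartition-reverse as)) 1≤sum) ⟩
  + (length (reverse as) + sum (reverse as)) - + 1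
    ≡⟨ cong (λ n → + n - + 1) (cong₂ _+_ (length-reverse as) (sum-reverse as)) ⟩
  + (length as + sum as) - + 1
    ≡⟨ cong (λ n → + n - + 1) (length-lPartition as) ⟨
  + length (lPartition as) - + 1
    ∎
  where open ≡-Reasoning

toRR : List ℕ → List ℕ
toRR xs = rrPartition (reverse (lCode xs))

toL : List ℕ → List ℕ
toL ys = lPartition (reverse (rrCode ys))

toL-toRR : ∀ {xs} → Positive xs → NonIncreasing xs → largest xs ≤ mult (largest xs) xs → toL (toRR xs) ≡ xs
toL-toRR {xs} ps ni square = begin
  lPartition (reverse (rrCode (rrPartition (reverse (lCode xs)))))
    ≡⟨ cong (lPartition ∘ reverse) (rrCode-rrPartition (reverse (lCode xs))) ⟩
  lPartition (reverse (reverse (lCode xs)))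
    ≡⟨ cong lPartition (reverse-involutive (lCode xs)) ⟩
  lPartition (lCode xs)
    ≡⟨ lPartition-lCode ps ni square ⟩
  xs
    ∎
  where open ≡-Reasoning

toRR-toL : ∀ {ys} → RRLinked ys → Positive ys → toRR (toL ys) ≡ ys
toRR-toL {ys} rr ps = begin
  rrPartition (reverse (lCode (lPartition (reverse (rrCode ys)))))
    ≡⟨ cong (rrPartition ∘ reverse) (lCode-lPartition (reverse (rrCode ys))) ⟩
  rrPartition (reverse (reverse (rrCode ys)))
    ≡⟨ cong rrPartition (reverse-involutive (rrCode ys)) ⟩
  rrPartition (rrCode ys)
    ≡⟨ rrPartition-rrCode rr ps ⟩
  ys
    ∎
  where open ≡-Reasoning

module _ {m N : ℕ} (1≤N : 1 ≤ N) where

  LCond⇒RCond : ∀ as → LCond m N (lPartition as) → RCond (+ m - + 1) N (rrPartition (reverse as))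
  LCond⇒RCond as ((_ , _ , sum≡N) , length≡m , _) =
    (rrPartition-positive _ , rrPartition-rrLinked _ , trans (sum-rrPartition-reverse as) sum≡N) ,
    trans (rank-rrPartition-reverse as (subst (1 ≤_) (sym sum≡N) 1≤N)) (cong (λ n → + n - + 1) length≡m)

  RCond⇒LCond : ∀ as → RCond (+ m - + 1) N (rrPartition (reverse as)) → LCond m N (lPartition as)
  RCond⇒LCond as ((_ , _ , sum≡N) , rank≡) =
    (lPartition-positive as , lPartition-nonIncreasing as , sum≡) ,
    +[m]-1-injective (trans (sym (rank-rrPartition-reverse as (subst (1 ≤_) (sym sum≡) 1≤N))) rank≡) ,
    lPartition-square as
    where
    sum≡ : sum (lPartition as) ≡ N
    sum≡ = trans (sym (sum-rrPartition-reverse as)) sum≡N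

  toRR-RCond : ∀ {xs} → LCond m N xs → RCond (+ m - + 1) N (toRR xs)
  toRR-RCond {xs} lc@((ps , ni , _) , _ , square) =
    LCond⇒RCond (lCode xs) (subst (LCond m N) (sym (lPartition-lCode ps ni square)) lc)

  toL-LCond : ∀ {ys} → RCond (+ m - + 1) N ys → LCond m N (toL ys)
  toL-LCond {ys} rc@((ps , rr , _) , _) = RCond⇒LCond (reverse (rrCode ys)) (subst (RCond _ N) (sym ys≡) rc)
    where
    ys≡ : rrPartition (reverse (reverse (rrCode ys))) ≡ ys
    ys≡ = trans (cong rrPartition (reverse-involutive _)) (rrPartition-rrCode rr ps)

theorem2p1 : (m N : ℕ) → 1 ≤ N → L m N ≡ R (+ m - + 1) N
theorem2p1 m N 1≤N = length-filter-≡ (LCond? m N) (RCond? (+ m - + 1) N) (candidates-unique N) (candidates-unique N)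
  (λ ((ps , _ , sum≡N) , _) → positive∈candidates ps sum≡N)
  (λ ((ps , _ , sum≡N) , _) → positive∈candidates ps sum≡N)
  toRR toL (toRR-RCond 1≤N) (toL-LCond 1≤N)
  (λ ((ps , ni , _) , _ , square) → toL-toRR ps ni square)
  (λ ((ps , rr , _) , _) → toRR-toL rr ps)
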